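{- Let $m\geqslant 2$, $k\geqslant 1$, $u\in\mathcal{A}_m^*$ and $1\leqslant\ell\leqslant k$. For all $j\in\mathbb{Z}$, \[\binom{\sigma_m^k(u)}{0\,\overline{1}\cdots\overline{\ell-1}}=\binom{\sigma_m^k(u)}{\overline{j}\,\overline{j+1}\cdots\overline{j+\ell-1}}.\]
   Context: $\mathcal{A}_m=\{0,\ldots,m-1\}=\mathbb{Z}/m\mathbb{Z}$; letters are reduced mod $m$ and $\overline{a}$ denotes the letter $-a\bmod m$. $\sigma_m$ is the morphism $\sigma_m(i)=i\,(i+1)\cdots(i+m-1)$. $\binom{u}{w}$ is the number of occurrences of $w$ as a (not necessarily contiguous) subword of $u$. -}

module Defs where

open import Data.Nat using (ℕ; zero; suc; _+_; NonZero)
open import Data.Integer as ℤ using (ℤ; +_; _%ℕ_)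
open import Data.Fin using (Fin; toℕ; fromℕ<)
open import Data.Nat.DivMod using (m%n<n)
open import Data.List using (List; []; _∷_; map; concatMap; upTo)
open import Data.Nat.GeneralisedArithmetic using (iterate)
open import Relation.Binary.PropositionalEquality using (_≡_)
open import Relation.Nullary.Decidable using (does)
open import Data.Fin.Properties using (_≟_)
open import Data.Bool using (if_then_else_)

-- The alphabet A_m = Z/mZ, represented by Fin m.
Letter : ℕ → Set
Letter m = Fin m

letter : (m : ℕ) .{{_ : NonZero m}} → ℤ → Letter m
letter m z = fromℕ< (m%n<n (z %ℕ m) m)

ι : {m : ℕ} → Letter m → ℤ
ι a = + toℕ a

bar : (m : ℕ) .{{_ : NonZero m}} → ℤ → Letter m
bar m a = letter m (ℤ.- a)

σ-letter : (m : ℕ) .{{_ : NonZero m}} → Letter m → List (Letter m)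
σ-letter m i = map (λ t → letter m (ι i ℤ.+ + t)) (upTo m)

σ : (m : ℕ) .{{_ : NonZero m}} → List (Letter m) → List (Letter m)
σ m = concatMap (σ-letter m)

σ^ : (m : ℕ) .{{_ : NonZero m}} → ℕ → List (Letter m) → List (Letter m)
σ^ m k u = iterate (σ m) u k

binom : {m : ℕ} → List (Letter m) → List (Letter m) → ℕ
binom u       []      = 1
binom []      (_ ∷ _) = 0
binom (a ∷ u) (b ∷ w) =
  (if does (a ≟ b) then binom u w else 0) + binom u (b ∷ w)

barRun : (m : ℕ) .{{_ : NonZero m}} → ℤ → ℕ → List (Letter m)
barRun m j ℓ = map (λ t → bar m (j ℤ.+ + t)) (upTo ℓ)

-- Write N_x(j, ℓ) for the number of occurrences of bar(j) bar(j+1) ⋯ bar(j+ℓ-1) in x. By induction on k,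
-- N_x(j, ℓ) does not depend on j when x = σ^k(c) and ℓ ≤ k; this passes to every σ^k(u) because
-- N_xy(j, ℓ) = Σ_{p+q=ℓ} N_x(j, p) N_y(j+p, q). In σ^{k+1}(c) = σ^k(c) σ^k(c+1) ⋯ σ^k(c+m-1) the lengths
-- ℓ ≤ k are covered by the induction hypothesis. For ℓ = k+1, occurrences meeting several blocks are
-- counted by products of shorter, hence j-independent, counts; those inside one block contribute
-- Σ_i N_σ^k(c+i)(j, k+1) = Σ_i N_σ^k(c)(j+i, k+1), since translating all letters commutes with σ,
-- and this sum of an m-periodic function of i over a full period does not depend on j.

module Submission where

open import Data.Fin using (toℕ)
import Data.Fin.Properties as Finₚ
open import Data.Integer as ℤ using (ℤ; +_; _%ℕ_; _/ℕ_; ∣_∣)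
open import Data.Integer.DivMod using (a≡a%ℕn+[a/ℕn]*n; n%ℕd<d)
import Data.Integer.Properties as ℤₚ
import Data.Integer.Tactic.RingSolver as ℤ-Solver
open import Data.List using (List; []; _∷_; [_]; _++_; _∷ʳ_; map; concatMap; upTo; applyUpTo)
open import Data.List.Properties
  using (map-cong; map-∘; map-upTo; applyUpTo-∷ʳ; ++-identityʳ;
         concatMap-++; concatMap-map; concatMap-cong; map-concatMap)
open import Data.List.Relation.Binary.Permutation.Propositional.Properties using (∷↭∷ʳ)
open import Data.Nat as ℕ using (ℕ; zero; suc; _+_; _*_; _≤_; _<_; s≤s; z<s; NonZero)
open import Data.Nat.DivMod using (m<n⇒m%n≡m; [m+n]%n≡m%n)
open import Data.Nat.GeneralisedArithmetic using (iterate)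
open import Data.Nat.ListAction using (sum)
open import Data.Nat.ListAction.Properties using (sum-↭)
import Data.Nat.Properties as ℕₚ
open import Algebra.Properties.CommutativeSemigroup ℕₚ.+-commutativeSemigroup using (interchange; x∙yz≈y∙xz)
import Data.Nat.Tactic.RingSolver as ℕ-Solver
open import Data.Sum using (inj₁; inj₂)
open import Function using (_∘_; _∘′_)
open import Function.Definitions using (Injective)
open import Level using (Level)
open import Relation.Binary.PropositionalEquality
  using (_≡_; refl; sym; trans; cong; cong₂; subst; subst₂; module ≡-Reasoning)
open import Relation.Nullary using (yes; no; contradiction)

open import Defs

private
  variable
    a : Level
    A : Set a

iterate-commute : (f g : A → A) → (∀ x → f (g x) ≡ g (f x)) →
                  ∀ x k → iterate f (g x) k ≡ g (iterate f x k)
iterate-commute f g fg x zero    = refl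
iterate-commute f g fg x (suc k) =
  trans (cong (λ y → iterate f y k) (fg x)) (iterate-commute f g fg (f x) k)

iterate-hom₂ : (f : A → A) (_∙_ : A → A → A) → (∀ x y → f (x ∙ y) ≡ f x ∙ f y) →
               ∀ k x y → iterate f (x ∙ y) k ≡ iterate f x k ∙ iterate f y k
iterate-hom₂ f _∙_ hom zero    x y = refl
iterate-hom₂ f _∙_ hom (suc k) x y =
  trans (cong (λ z → iterate f z k) (hom x y)) (iterate-hom₂ f _∙_ hom k (f x) (f y))

iterate-fixed : (f : A → A) {x : A} → f x ≡ x → ∀ k → iterate f x k ≡ x
iterate-fixed f fx≡x zero    = refl
iterate-fixed f fx≡x (suc k) = trans (cong (λ y → iterate f y k) fx≡x) (iterate-fixed f fx≡x k)

sumSplits : (List A → List A → ℕ) → List A → ℕ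
sumSplits F []      = F [] []
sumSplits F (b ∷ w) = F [] (b ∷ w) + sumSplits (λ u v → F (b ∷ u) v) w

sumSplits-cong : {F G : List A → List A → ℕ} → (∀ u v → F u v ≡ G u v) →
                 ∀ w → sumSplits F w ≡ sumSplits G w
sumSplits-cong F≗G []      = F≗G [] []
sumSplits-cong F≗G (b ∷ w) = cong₂ _+_ (F≗G [] (b ∷ w)) (sumSplits-cong (λ u → F≗G (b ∷ u)) w)

sumSplits-+ : (F G : List A → List A → ℕ) →
              ∀ w → sumSplits (λ u v → F u v + G u v) w ≡ sumSplits F w + sumSplits G w
sumSplits-+ F G []      = refl
sumSplits-+ F G (b ∷ w) = trans (cong (_+_ (F [] (b ∷ w) + G [] (b ∷ w))) (sumSplits-+ _ _ w))
                                (interchange (F [] (b ∷ w)) (G [] (b ∷ w)) _ _)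

sumSplits-0 : (w : List A) → sumSplits (λ _ _ → 0) w ≡ 0
sumSplits-0 []      = refl
sumSplits-0 (b ∷ w) = sumSplits-0 w

-- Σ F p q over p + q ≡ ℓ with q ≥ 1.
sumAntidiagonal⁺ : (ℕ → ℕ → ℕ) → ℕ → ℕ
sumAntidiagonal⁺ F zero    = 0
sumAntidiagonal⁺ F (suc ℓ) = F 0 (suc ℓ) + sumAntidiagonal⁺ (λ p q → F (suc p) q) ℓ

sumAntidiagonal : (ℕ → ℕ → ℕ) → ℕ → ℕ
sumAntidiagonal F ℓ = sumAntidiagonal⁺ F ℓ + F ℓ 0

sumAntidiagonal⁺-cong : ∀ ℓ {F G : ℕ → ℕ → ℕ} →
                        (∀ p q → p + suc q ≡ ℓ → F p (suc q) ≡ G p (suc q)) →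
                        sumAntidiagonal⁺ F ℓ ≡ sumAntidiagonal⁺ G ℓ
sumAntidiagonal⁺-cong zero    F≗G = refl
sumAntidiagonal⁺-cong (suc ℓ) F≗G =
  cong₂ _+_ (F≗G 0 ℓ refl) (sumAntidiagonal⁺-cong ℓ (λ p q e → F≗G (suc p) q (cong suc e)))

sumAntidiagonal-cong : ∀ ℓ {F G : ℕ → ℕ → ℕ} → (∀ p q → p + q ≡ ℓ → F p q ≡ G p q) →
                       sumAntidiagonal F ℓ ≡ sumAntidiagonal G ℓ
sumAntidiagonal-cong ℓ F≗G =
  cong₂ _+_ (sumAntidiagonal⁺-cong ℓ (λ p q → F≗G p (suc q))) (F≗G ℓ 0 (ℕₚ.+-identityʳ ℓ))

sumSplits-applyUpTo : (F : List A → List A → ℕ) (g : ℕ → A) → ∀ ℓ →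
  sumSplits F (applyUpTo g ℓ) ≡ sumAntidiagonal (λ p q → F (applyUpTo g p) (applyUpTo (g ∘ _+_ p) q)) ℓ
sumSplits-applyUpTo F g zero    = refl
sumSplits-applyUpTo F g (suc ℓ) =
  trans (cong (_+_ (F [] (applyUpTo g (suc ℓ)))) (sumSplits-applyUpTo (λ u → F (g 0 ∷ u)) (g ∘ suc) ℓ))
        (sym (ℕₚ.+-assoc (F [] (applyUpTo g (suc ℓ))) _ _))

sum-rotate : (h : ℕ → ℕ) → ∀ n → h n ≡ h 0 →
             sum (map (h ∘ suc) (upTo n)) ≡ sum (map h (upTo n))
sum-rotate h zero    _      = refl
sum-rotate h (suc n) hn≡h0 = begin
  sum (map (h ∘ suc) (upTo (suc n)))          ≡⟨ cong sum (map-upTo (h ∘ suc) (suc n)) ⟩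
  sum (applyUpTo (h ∘ suc) (suc n))           ≡⟨ cong sum (applyUpTo-∷ʳ (h ∘ suc) n) ⟨
  sum (applyUpTo (h ∘ suc) n ∷ʳ h (suc n))    ≡⟨ cong (sum ∘ (applyUpTo (h ∘ suc) n ∷ʳ_)) hn≡h0 ⟩
  sum (applyUpTo (h ∘ suc) n ∷ʳ h 0)          ≡⟨ sum-↭ (∷↭∷ʳ (h 0) (applyUpTo (h ∘ suc) n)) ⟨
  sum (applyUpTo h (suc n))                   ≡⟨ cong sum (map-upTo h (suc n)) ⟨
  sum (map h (upTo (suc n)))                  ∎
  where open ≡-Reasoning

sum-window-periodic : (h : ℕ → ℕ) → ∀ n → (∀ i → h (i + n) ≡ h i) →
                      ∀ i → sum (map (λ t → h (i + t)) (upTo n)) ≡ sum (map h (upTo n))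
sum-window-periodic h n periodic zero    = refl
sum-window-periodic h n periodic (suc i) = begin
  sum (map (λ t → h (suc i + t)) (upTo n))
    ≡⟨ cong sum (map-cong (λ t → cong h (ℕₚ.+-suc i t)) (upTo n)) ⟨
  sum (map (hᵢ ∘ suc) (upTo n))
    ≡⟨ sum-rotate hᵢ n (trans (periodic i) (cong h (sym (ℕₚ.+-identityʳ i)))) ⟩
  sum (map hᵢ (upTo n))                    ≡⟨ sum-window-periodic h n periodic i ⟩
  sum (map h (upTo n))                     ∎
  where
  open ≡-Reasoning
  hᵢ : ℕ → ℕ
  hᵢ t = h (i + t)

binom-++ : ∀ {m} (x y w : List (Letter m)) →
           binom (x ++ y) w ≡ sumSplits (λ u v → binom x u * binom y v) w
binom-++ x       y []      = refl
binom-++ []      y (b ∷ w) =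
  sym (trans (cong (_+_ (binom y (b ∷ w) + 0)) (sumSplits-0 w))
             (trans (ℕₚ.+-identityʳ _) (ℕₚ.+-identityʳ _)))
binom-++ (a ∷ x) y (b ∷ w) with a Finₚ.≟ b
... | no _  = binom-++ x y (b ∷ w)
... | yes _ = begin
  binom (x ++ y) w + binom (x ++ y) (b ∷ w)
    ≡⟨ cong₂ _+_ (binom-++ x y w) (binom-++ x y (b ∷ w)) ⟩
  sumSplits F w + (binom y (b ∷ w) + 0 + sumSplits F′ w)
    ≡⟨ x∙yz≈y∙xz (sumSplits F w) (binom y (b ∷ w) + 0) (sumSplits F′ w) ⟩
  binom y (b ∷ w) + 0 + (sumSplits F w + sumSplits F′ w)
    ≡⟨ cong (_+_ (binom y (b ∷ w) + 0)) (sumSplits-+ F F′ w) ⟨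
  binom y (b ∷ w) + 0 + sumSplits (λ u v → F u v + F′ u v) w
    ≡⟨ cong (_+_ (binom y (b ∷ w) + 0))
            (sumSplits-cong (λ u v → ℕₚ.*-distribʳ-+ (binom y v) (binom x u) _) w) ⟨
  binom y (b ∷ w) + 0 + sumSplits (λ u v → (binom x u + binom x (b ∷ u)) * binom y v) w ∎
  where
  open ≡-Reasoning
  F F′ : List _ → List _ → ℕ
  F  u v = binom x u * binom y v
  F′ u v = binom x (b ∷ u) * binom y v

binom-map : ∀ {m n} (f : Letter m → Letter n) → Injective _≡_ _≡_ f →
            ∀ x w → binom (map f x) (map f w) ≡ binom x w
binom-map f f-inj x       []      = refl
binom-map f f-inj []      (b ∷ w) = refl
binom-map f f-inj (a ∷ x) (b ∷ w) with a Finₚ.≟ b | f a Finₚ.≟ f b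
... | yes _   | yes _     = cong₂ _+_ (binom-map f f-inj x w) (binom-map f f-inj x (b ∷ w))
... | no _    | no _      = binom-map f f-inj x (b ∷ w)
... | yes a≡b | no fa≢fb  = contradiction (cong f a≡b) fa≢fb
... | no a≢b  | yes fa≡fb = contradiction (f-inj fa≡fb) a≢b

module _ (m : ℕ) .{{_ : NonZero m}} where

  %ℕ-unique : ∀ z q {r} → r < m → z ≡ + r ℤ.+ q ℤ.* + m → z %ℕ m ≡ r
  %ℕ-unique z q {r} r<m z≡r+qm =
    ℤₚ.+-injective (ℤₚ.i-j≡0⇒i≡j (+ r′) (+ r) (ℤₚ.∣i∣≡0⇒i≡0 ∣r′-r∣≡0))
    where
    r′ = z %ℕ m
    q′ = z /ℕ m
    r′-r≡[q-q′]m : + r′ ℤ.- + r ≡ (q ℤ.- q′) ℤ.* + m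
    r′-r≡[q-q′]m = begin
      + r′ ℤ.- + r
        ≡⟨ regroup (+ r′) (+ r) q q′ (+ m) ⟩
      (q ℤ.- q′) ℤ.* + m ℤ.+ ((+ r′ ℤ.+ q′ ℤ.* + m) ℤ.- (+ r ℤ.+ q ℤ.* + m))
        ≡⟨ cong₂ (λ s t → (q ℤ.- q′) ℤ.* + m ℤ.+ (s ℤ.- t)) (a≡a%ℕn+[a/ℕn]*n z m) z≡r+qm ⟨
      (q ℤ.- q′) ℤ.* + m ℤ.+ (z ℤ.- z)
        ≡⟨ cancel ((q ℤ.- q′) ℤ.* + m) z ⟩
      (q ℤ.- q′) ℤ.* + m ∎
      where
      open ≡-Reasoning
      regroup : ∀ a b c d M →
                a ℤ.- b ≡ (c ℤ.- d) ℤ.* M ℤ.+ ((a ℤ.+ d ℤ.* M) ℤ.- (b ℤ.+ c ℤ.* M))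
      regroup = ℤ-Solver.solve-∀
      cancel : ∀ t z → t ℤ.+ (z ℤ.- z) ≡ t
      cancel = ℤ-Solver.solve-∀
    ∣r′-r∣<m : ∣ + r′ ℤ.- + r ∣ < m
    ∣r′-r∣<m = begin-strict
      ∣ + r′ ℤ.- + r ∣ ≡⟨ cong ∣_∣ (ℤₚ.[+m]-[+n]≡m⊖n r′ r) ⟩
      ∣ r′ ℤ.⊖ r ∣     ≤⟨ ℤₚ.∣m⊝n∣≤m⊔n r′ r ⟩
      r′ ℕ.⊔ r         <⟨ ℕₚ.⊔-pres-<m (n%ℕd<d z m) r<m ⟩
      m                ∎
      where open ℕₚ.≤-Reasoning
    ∣r′-r∣≡∣q-q′∣m : ∣ + r′ ℤ.- + r ∣ ≡ ∣ q ℤ.- q′ ∣ * m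
    ∣r′-r∣≡∣q-q′∣m = trans (cong ∣_∣ r′-r≡[q-q′]m) (ℤₚ.abs-* (q ℤ.- q′) (+ m))
    ∣q-q′∣≡0 : ∣ q ℤ.- q′ ∣ ≡ 0
    ∣q-q′∣≡0 = ℕₚ.n<1⇒n≡0 (ℕₚ.*-cancelʳ-< m _ 1
      (subst₂ _<_ ∣r′-r∣≡∣q-q′∣m (sym (ℕₚ.*-identityˡ m)) ∣r′-r∣<m))
    ∣r′-r∣≡0 : ∣ + r′ ℤ.- + r ∣ ≡ 0
    ∣r′-r∣≡0 = trans ∣r′-r∣≡∣q-q′∣m (cong (_* m) ∣q-q′∣≡0)

  [i+qm]%ℕm≡i%ℕm : ∀ z q → (z ℤ.+ q ℤ.* + m) %ℕ m ≡ z %ℕ m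
  [i+qm]%ℕm≡i%ℕm z q = %ℕ-unique (z ℤ.+ q ℤ.* + m) (z /ℕ m ℤ.+ q) (n%ℕd<d z m) (begin
    z ℤ.+ q ℤ.* + m                               ≡⟨ cong (ℤ._+ q ℤ.* + m) (a≡a%ℕn+[a/ℕn]*n z m) ⟩
    + (z %ℕ m) ℤ.+ z /ℕ m ℤ.* + m ℤ.+ q ℤ.* + m   ≡⟨ regroup (+ (z %ℕ m)) (z /ℕ m) q (+ m) ⟩
    + (z %ℕ m) ℤ.+ (z /ℕ m ℤ.+ q) ℤ.* + m         ∎)
    where
    open ≡-Reasoning
    regroup : ∀ r a b M → r ℤ.+ a ℤ.* M ℤ.+ b ℤ.* M ≡ r ℤ.+ (a ℤ.+ b) ℤ.* M
    regroup = ℤ-Solver.solve-∀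

  toℕ-letter : ∀ z → toℕ (letter m z) ≡ z %ℕ m
  toℕ-letter z = trans (Finₚ.toℕ-fromℕ< _) (m<n⇒m%n≡m (n%ℕd<d z m))

  letter-cong : ∀ z z′ → z %ℕ m ≡ z′ %ℕ m → letter m z ≡ letter m z′
  letter-cong z z′ eq = Finₚ.toℕ-injective (trans (toℕ-letter z) (trans eq (sym (toℕ-letter z′))))

  letter-ι : ∀ a → letter m (ι a) ≡ a
  letter-ι a = Finₚ.toℕ-injective (trans (toℕ-letter (ι a)) (m<n⇒m%n≡m (Finₚ.toℕ<n a)))

  letter-+m : ∀ n → letter m (+ (n + m)) ≡ letter m (+ n)
  letter-+m n = letter-cong (+ (n + m)) (+ n) ([m+n]%n≡m%n n m)

  shift : ℤ → Letter m → Letter m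
  shift n a = letter m (ι a ℤ.+ n)

  shift-letter : ∀ n z → shift n (letter m z) ≡ letter m (z ℤ.+ n)
  shift-letter n z = letter-cong (ι (letter m z) ℤ.+ n) (z ℤ.+ n) (begin
    (ι (letter m z) ℤ.+ n) %ℕ m                ≡⟨ cong (λ r → (+ r ℤ.+ n) %ℕ m) (toℕ-letter z) ⟩
    (+ (z %ℕ m) ℤ.+ n) %ℕ m                    ≡⟨ [i+qm]%ℕm≡i%ℕm (+ (z %ℕ m) ℤ.+ n) (z /ℕ m) ⟨
    (+ (z %ℕ m) ℤ.+ n ℤ.+ z /ℕ m ℤ.* + m) %ℕ m
      ≡⟨ cong (_%ℕ m) (swap (+ (z %ℕ m)) n (z /ℕ m ℤ.* + m)) ⟩
    (+ (z %ℕ m) ℤ.+ z /ℕ m ℤ.* + m ℤ.+ n) %ℕ m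
      ≡⟨ cong (λ t → (t ℤ.+ n) %ℕ m) (a≡a%ℕn+[a/ℕn]*n z m) ⟨
    (z ℤ.+ n) %ℕ m                             ∎)
    where
    open ≡-Reasoning
    swap : ∀ a b c → a ℤ.+ b ℤ.+ c ≡ a ℤ.+ c ℤ.+ b
    swap = ℤ-Solver.solve-∀

  shift-inverse : ∀ n a → shift (ℤ.- n) (shift n a) ≡ a
  shift-inverse n a = trans (shift-letter (ℤ.- n) (ι a ℤ.+ n))
                            (trans (cong (letter m) (cancel (ι a) n)) (letter-ι a))
    where
    cancel : ∀ x n → x ℤ.+ n ℤ.- n ≡ x
    cancel = ℤ-Solver.solve-∀

  shift-injective : ∀ n → Injective _≡_ _≡_ (shift n)
  shift-injective n {a} {b} eq =
    trans (sym (shift-inverse n a)) (trans (cong (shift (ℤ.- n)) eq) (shift-inverse n b))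

  σ-letter-shift : ∀ n a → σ-letter m (shift n a) ≡ map (shift n) (σ-letter m a)
  σ-letter-shift n a = trans (map-cong shift-step (upTo m)) (map-∘ (upTo m))
    where
    swap : ∀ x n t → x ℤ.+ n ℤ.+ t ≡ x ℤ.+ t ℤ.+ n
    swap = ℤ-Solver.solve-∀
    shift-step : ∀ t → letter m (ι (shift n a) ℤ.+ + t) ≡ shift n (letter m (ι a ℤ.+ + t))
    shift-step t = trans (shift-letter (+ t) (ι a ℤ.+ n))
                         (trans (cong (letter m) (swap (ι a) n (+ t))) (sym (shift-letter n (ι a ℤ.+ + t))))

  σ-map-shift : ∀ n x → σ m (map (shift n) x) ≡ map (shift n) (σ m x)
  σ-map-shift n x = begin
    concatMap (σ-letter m) (map (shift n) x)    ≡⟨ concatMap-map (σ-letter m) (shift n) x ⟩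
    concatMap (σ-letter m ∘′ shift n) x         ≡⟨ concatMap-cong (σ-letter-shift n) x ⟩
    concatMap (map (shift n) ∘′ σ-letter m) x   ≡⟨ map-concatMap (shift n) (σ-letter m) x ⟨
    map (shift n) (concatMap (σ-letter m) x)    ∎
    where open ≡-Reasoning

  σ^-map-shift : ∀ n k x → σ^ m k (map (shift n) x) ≡ map (shift n) (σ^ m k x)
  σ^-map-shift n k x = iterate-commute (σ m) (map (shift n)) (σ-map-shift n) x k

  σ^-++ : ∀ k x y → σ^ m k (x ++ y) ≡ σ^ m k x ++ σ^ m k y
  σ^-++ = iterate-hom₂ (σ m) _++_ (concatMap-++ (σ-letter m))

  σ^-[] : ∀ k → σ^ m k [] ≡ []
  σ^-[] = iterate-fixed (σ m) refl

  barRun-shift : ∀ n j ℓ → map (shift n) (barRun m j ℓ) ≡ barRun m (j ℤ.- n) ℓ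
  barRun-shift n j ℓ = trans (sym (map-∘ (upTo ℓ))) (map-cong shift-bar (upTo ℓ))
    where
    regroup : ∀ j t n → ℤ.- (j ℤ.+ t) ℤ.+ n ≡ ℤ.- (j ℤ.- n ℤ.+ t)
    regroup = ℤ-Solver.solve-∀
    shift-bar : ∀ t → shift n (bar m (j ℤ.+ + t)) ≡ bar m (j ℤ.- n ℤ.+ + t)
    shift-bar t = trans (shift-letter n (ℤ.- (j ℤ.+ + t))) (cong (letter m) (regroup j (+ t) n))

  sum-σ-letter : (G : Letter m → ℕ) → ∀ c →
                 sum (map G (σ-letter m c)) ≡ sum (map (λ t → G (letter m (+ t))) (upTo m))
  sum-σ-letter G c = begin
    sum (map G (σ-letter m c))                            ≡⟨ cong sum (map-∘ (upTo m)) ⟨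
    sum (map (λ t → G (letter m (ι c ℤ.+ + t))) (upTo m))
      ≡⟨ cong sum (map-cong (λ t → cong (G ∘ letter m) (ℤₚ.pos-+ (toℕ c) t)) (upTo m)) ⟨
    sum (map (λ t → H (toℕ c + t)) (upTo m))
      ≡⟨ sum-window-periodic H m (λ i → cong G (letter-+m i)) (toℕ c) ⟩
    sum (map H (upTo m))                                  ∎
    where
    open ≡-Reasoning
    H : ℕ → ℕ
    H t = G (letter m (+ t))

  Word : Set
  Word = List (Letter m)

  barCount : Word → ℤ → ℕ → ℕ
  barCount x j ℓ = binom x (barRun m j ℓ)

  barCount-shift : ∀ n x j ℓ → barCount (map (shift n) x) (j ℤ.- n) ℓ ≡ barCount x j ℓ
  barCount-shift n x j ℓ = trans (cong (binom (map (shift n) x)) (sym (barRun-shift n j ℓ)))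
                                 (binom-map (shift n) (shift-injective n) x (barRun m j ℓ))

  barCount-σ^-shift : ∀ k d j ℓ → barCount (σ^ m k [ d ]) j ℓ ≡ barCount (σ^ m k [ shift j d ]) (+ 0) ℓ
  barCount-σ^-shift k d j ℓ = sym (trans
    (cong₂ (λ x i → barCount x i ℓ) (σ^-map-shift j k [ d ]) (sym (ℤₚ.+-inverseʳ j)))
    (barCount-shift j (σ^ m k [ d ]) j ℓ))

  barCount-++ : ∀ x y j ℓ →
    barCount (x ++ y) j ℓ ≡ sumAntidiagonal (λ p q → barCount x j p * barCount y (j ℤ.+ + p) q) ℓ
  barCount-++ x y j ℓ = begin
    binom (x ++ y) (barRun m j ℓ)       ≡⟨ binom-++ x y (barRun m j ℓ) ⟩
    sumSplits F (barRun m j ℓ)          ≡⟨ cong (sumSplits F) (map-upTo (bars j) ℓ) ⟩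
    sumSplits F (applyUpTo (bars j) ℓ)  ≡⟨ sumSplits-applyUpTo F (bars j) ℓ ⟩
    sumAntidiagonal (λ p q → F (applyUpTo (bars j) p) (applyUpTo (bars j ∘ _+_ p) q)) ℓ
      ≡⟨ sumAntidiagonal-cong ℓ (λ p q _ → cong₂ F (sym (map-upTo (bars j) p)) (bars-from p q)) ⟩
    sumAntidiagonal (λ p q → barCount x j p * barCount y (j ℤ.+ + p) q) ℓ ∎
    where
    open ≡-Reasoning
    F : Word → Word → ℕ
    F u v = binom x u * binom y v
    bars : ℤ → ℕ → Letter m
    bars i t = bar m (i ℤ.+ + t)
    bars-from : ∀ p q → applyUpTo (bars j ∘ _+_ p) q ≡ barRun m (j ℤ.+ + p) q
    bars-from p q = begin
      applyUpTo (bars j ∘ _+_ p) q  ≡⟨ map-upTo (bars j ∘ _+_ p) q ⟨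
      map (bars j ∘ _+_ p) (upTo q) ≡⟨ map-cong (λ t → cong (bar m) (reassoc t)) (upTo q) ⟩
      barRun m (j ℤ.+ + p) q        ∎
      where
      reassoc : ∀ t → j ℤ.+ + (p + t) ≡ j ℤ.+ + p ℤ.+ + t
      reassoc t = trans (cong (ℤ._+_ j) (ℤₚ.pos-+ p t)) (sym (ℤₚ.+-assoc j (+ p) (+ t)))

  BarInvariant : ℕ → Word → Set
  BarInvariant ℓ x = ∀ p → p ≤ ℓ → ∀ i j → barCount x i p ≡ barCount x j p

  BarInvariant-[] : ∀ ℓ → BarInvariant ℓ []
  BarInvariant-[] ℓ zero    _ i j = refl
  BarInvariant-[] ℓ (suc p) _ i j = refl

  BarInvariant-++ : ∀ {ℓ x y} → BarInvariant ℓ x → BarInvariant ℓ y → BarInvariant ℓ (x ++ y)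
  BarInvariant-++ {ℓ} {x} {y} inv-x inv-y p p≤ℓ i j = begin
    barCount (x ++ y) i p                                                ≡⟨ barCount-++ x y i p ⟩
    sumAntidiagonal (λ a b → barCount x i a * barCount y (i ℤ.+ + a) b) p ≡⟨ sumAntidiagonal-cong p terms ⟩
    sumAntidiagonal (λ a b → barCount x j a * barCount y (j ℤ.+ + a) b) p ≡⟨ barCount-++ x y j p ⟨
    barCount (x ++ y) j p                                                ∎
    where
    open ≡-Reasoning
    terms : ∀ a b → a + b ≡ p →
            barCount x i a * barCount y (i ℤ.+ + a) b ≡ barCount x j a * barCount y (j ℤ.+ + a) b
    terms a b a+b≡p = cong₂ _*_ (inv-x a (ℕₚ.m+n≤o⇒m≤o a a+b≤ℓ) i j)
                                (inv-y b (ℕₚ.m+n≤o⇒n≤o a a+b≤ℓ) (i ℤ.+ + a) (j ℤ.+ + a))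
      where a+b≤ℓ = subst (_≤ ℓ) (sym a+b≡p) p≤ℓ

  BarInvariant-σ^ : ∀ {ℓ} k → (∀ c → BarInvariant ℓ (σ^ m k [ c ])) →
                    ∀ u → BarInvariant ℓ (σ^ m k u)
  BarInvariant-σ^ {ℓ} k inv []      = subst (BarInvariant ℓ) (sym (σ^-[] k)) (BarInvariant-[] ℓ)
  BarInvariant-σ^ {ℓ} k inv (c ∷ u) =
    subst (BarInvariant ℓ) (sym (σ^-++ k [ c ] u)) (BarInvariant-++ (inv c) (BarInvariant-σ^ k inv u))

  -- Occurrences of the run of length k + 1 that take p + 1 letters from x and q ≥ 1 from y.
  crossCount : Word → Word → ℤ → ℕ → ℕ
  crossCount x y j k = sumAntidiagonal⁺ (λ p q → barCount x j (suc p) * barCount y (j ℤ.+ + suc p) q) k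

  barCount-++-suc : ∀ x y j k →
    barCount (x ++ y) j (suc k) ≡ barCount y j (suc k) + crossCount x y j k + barCount x j (suc k)
  barCount-++-suc x y j k = trans (barCount-++ x y j (suc k))
    (cong₂ (λ s t → s + crossCount x y j k + t)
           (trans (ℕₚ.+-identityʳ _) (cong (λ i → barCount y i (suc k)) (ℤₚ.+-identityʳ j)))
           (ℕₚ.*-identityʳ _))

  crossCount-invariant : ∀ {k x y} → BarInvariant k x → BarInvariant k y →
                         ∀ i j → crossCount x y i k ≡ crossCount x y j k
  crossCount-invariant {k} inv-x inv-y i j = sumAntidiagonal⁺-cong k λ p q p+1+q≡k →
    cong₂ _*_ (inv-x (suc p) (1+p≤k p q p+1+q≡k) i j)
              (inv-y (suc q) (1+q≤k p q p+1+q≡k) (i ℤ.+ + suc p) (j ℤ.+ + suc p))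
    where
    1+p≤k : ∀ p q → p + suc q ≡ k → suc p ≤ k
    1+p≤k p q refl = ℕₚ.m<m+n p z<s
    1+q≤k : ∀ p q → p + suc q ≡ k → suc q ≤ k
    1+q≤k p q refl = ℕₚ.m≤n+m (suc q) p

  blockCount : ℕ → Word → ℤ → ℕ
  blockCount k v j = sum (map (λ d → barCount (σ^ m k [ d ]) j (suc k)) v)

  crossTotal : ℕ → Word → ℤ → ℕ
  crossTotal k []      j = 0
  crossTotal k (d ∷ v) j = crossCount (σ^ m k [ d ]) (σ^ m k v) j k + crossTotal k v j

  barCount-σ^-suc : ∀ k v j → barCount (σ^ m k v) j (suc k) ≡ blockCount k v j + crossTotal k v j
  barCount-σ^-suc k []      j = cong (λ x → barCount x j (suc k)) (σ^-[] k)
  barCount-σ^-suc k (d ∷ v) j = begin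
    barCount (σ^ m k (d ∷ v)) j (suc k)          ≡⟨ cong (λ x → barCount x j (suc k)) (σ^-++ k [ d ] v) ⟩
    barCount (σ^ m k [ d ] ++ σ^ m k v) j (suc k) ≡⟨ barCount-++-suc (σ^ m k [ d ]) (σ^ m k v) j k ⟩
    barCount (σ^ m k v) j (suc k) + C + B         ≡⟨ cong (λ s → s + C + B) (barCount-σ^-suc k v j) ⟩
    blockCount k v j + crossTotal k v j + C + B   ≡⟨ regroup (blockCount k v j) (crossTotal k v j) C B ⟩
    B + blockCount k v j + (C + crossTotal k v j) ∎
    where
    open ≡-Reasoning
    B = barCount (σ^ m k [ d ]) j (suc k)
    C = crossCount (σ^ m k [ d ]) (σ^ m k v) j k
    regroup : ∀ a b c d → a + b + c + d ≡ d + a + (c + b)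
    regroup = ℕ-Solver.solve-∀

  crossTotal-invariant : ∀ k → (∀ c → BarInvariant k (σ^ m k [ c ])) →
                         ∀ v i j → crossTotal k v i ≡ crossTotal k v j
  crossTotal-invariant k inv []      i j = refl
  crossTotal-invariant k inv (d ∷ v) i j =
    cong₂ _+_ (crossCount-invariant (inv d) (BarInvariant-σ^ k inv v) i j) (crossTotal-invariant k inv v i j)

  blockCount-σ-letter : ∀ k c j →
    blockCount k (σ-letter m c) j
      ≡ sum (map (λ t → barCount (σ^ m k [ letter m (+ t) ]) (+ 0) (suc k)) (upTo m))
  blockCount-σ-letter k c j = begin
    sum (map (λ d → barCount (σ^ m k [ d ]) j (suc k)) (σ-letter m c))
      ≡⟨ cong sum (map-cong (λ d → barCount-σ^-shift k d j (suc k)) (σ-letter m c)) ⟩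
    sum (map (G ∘ shift j) (σ-letter m c))  ≡⟨ cong sum (map-∘ (σ-letter m c)) ⟩
    sum (map G (map (shift j) (σ-letter m c))) ≡⟨ cong (sum ∘ map G) (σ-letter-shift j c) ⟨
    sum (map G (σ-letter m (shift j c)))    ≡⟨ sum-σ-letter G (shift j c) ⟩
    sum (map (λ t → G (letter m (+ t))) (upTo m)) ∎
    where
    open ≡-Reasoning
    G : Letter m → ℕ
    G d = barCount (σ^ m k [ d ]) (+ 0) (suc k)

  barCount-σ^-suc-invariant : ∀ k → (∀ c → BarInvariant k (σ^ m k [ c ])) →
    ∀ c i j → barCount (σ^ m (suc k) [ c ]) i (suc k) ≡ barCount (σ^ m (suc k) [ c ]) j (suc k)
  barCount-σ^-suc-invariant k inv c i j = begin
    barCount (σ^ m k (σ m [ c ])) i (suc k)                       ≡⟨ decompose i ⟩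
    blockCount k (σ-letter m c) i + crossTotal k (σ-letter m c) i
      ≡⟨ cong₂ _+_ (trans (blockCount-σ-letter k c i) (sym (blockCount-σ-letter k c j)))
                   (crossTotal-invariant k inv (σ-letter m c) i j) ⟩
    blockCount k (σ-letter m c) j + crossTotal k (σ-letter m c) j ≡⟨ decompose j ⟨
    barCount (σ^ m k (σ m [ c ])) j (suc k)                       ∎
    where
    open ≡-Reasoning
    decompose : ∀ i → barCount (σ^ m k (σ m [ c ])) i (suc k)
                      ≡ blockCount k (σ-letter m c) i + crossTotal k (σ-letter m c) i
    decompose i = trans (cong (λ x → barCount (σ^ m k x) i (suc k)) (++-identityʳ (σ-letter m c)))
                     (barCount-σ^-suc k (σ-letter m c) i)

  σ^-BarInvariant : ∀ k c → BarInvariant k (σ^ m k [ c ])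
  σ^-BarInvariant zero    c zero    _      i j = refl
  σ^-BarInvariant (suc k) c p       p≤1+k i j with ℕₚ.m≤n⇒m<n∨m≡n p≤1+k
  ... | inj₁ (s≤s p≤k) = BarInvariant-σ^ k (σ^-BarInvariant k) (σ m [ c ]) p p≤k i j
  ... | inj₂ refl      = barCount-σ^-suc-invariant k (σ^-BarInvariant k) c i j

lemma4p3 : (m : ℕ) .{{_ : NonZero m}} → 2 ≤ m → (k : ℕ) → 1 ≤ k →
    (u : List (Letter m)) → (ℓ : ℕ) → 1 ≤ ℓ → ℓ ≤ k → (j : ℤ) →
    binom (σ^ m k u) (barRun m (+ 0) ℓ) ≡ binom (σ^ m k u) (barRun m j ℓ)
lemma4p3 m _ k _ u ℓ _ ℓ≤k j = BarInvariant-σ^ m k (σ^-BarInvariant m k) u ℓ ℓ≤k (+ 0) j
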